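{- For all integers $n,m,r,p,q$, $$G_{n+r+p}H_{m+r+q}-G_{n+r}H_{m+r+p+q}=(-1)^{n+r}\big(G_pH_{m-n+q}-G_0H_{m-n+p+q}\big).$$
   Context: $(G_n)_{n\in\mathbb Z}$ and $(H_n)_{n\in\mathbb Z}$ are generalized Fibonacci sequences: $G_{n+2}=G_{n+1}+G_n$ and $H_{n+2}=H_{n+1}+H_n$ for all integers $n$, with arbitrary initial values $G_0,G_1$ and $H_0,H_1$. -}

module Defs where

open import Level using (Level)
open import Data.Integer using (ℤ; +_; -[1+_])
open import Data.Nat using (ℕ; zero; suc)
open import Algebra.Bundles using (CommutativeRing)

IsGenFib : ∀ {c ℓ} (R : CommutativeRing c ℓ) → (ℤ → CommutativeRing.Carrier R) → Set _
IsGenFib R f = ∀ (n : ℤ) →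
  CommutativeRing._≈_ R (f (n Data.Integer.+ + 2))
                        (CommutativeRing._+_ R (f (n Data.Integer.+ + 1)) (f n))

negOnePowℕ : ∀ {c ℓ} (R : CommutativeRing c ℓ) → ℕ → CommutativeRing.Carrier R
negOnePowℕ R zero = CommutativeRing.1# R
negOnePowℕ R (suc k) = CommutativeRing.-_ R (negOnePowℕ R k)

-- (-1)^k for k ∈ ℤ; since (-1)^{-1} = -1, (-1)^k = (-1)^{|k|}
negOnePow : ∀ {c ℓ} (R : CommutativeRing c ℓ) → ℤ → CommutativeRing.Carrier R
negOnePow R k = negOnePowℕ R (Data.Integer.∣ k ∣)

{-# OPTIONS --safe #-}
-- For fixed s and p put D(a) = G(a+p) H(a+s) − G(a) H(a+s+p). As a function of p,
-- D(a+1) + D(a) is again a generalized Fibonacci sequence (the Fibonacci sequences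
-- are closed under shifts and linear combinations), and it vanishes at p = 0 and
-- p = 1, hence everywhere. So D(a+1) = −D(a), i.e. D(a) = (−1)^a D(0), which is
-- the identity with a = n + r and s = m − n + q.
module Submission where

open import Defs
open import Algebra.Bundles using (CommutativeRing)
open import Data.Integer as ℤ using (ℤ; +_; -[1+_])
import Data.Integer.Properties as ℤP
open import Algebra.Properties.CommutativeSemigroup ℤP.+-commutativeSemigroup using (xy∙z≈xz∙y)
import Data.Integer.Tactic.RingSolver as ℤ-Solver
open import Data.Nat using (suc)
import Data.Nat.Properties as ℕ
open import Data.Product using (_×_; _,_; proj₁)
open import Function using (_∘_)
open import Relation.Binary.PropositionalEquality as P using (_≡_)

ℤ-bidirectional-induction : ∀ {p} (P : ℤ → Set p) → P (+ 0) →
  (∀ i → P i → P (i ℤ.+ + 1)) → (∀ i → P (i ℤ.+ + 1) → P i) → ∀ i → P i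
ℤ-bidirectional-induction P base up down (+ 0) = base
ℤ-bidirectional-induction P base up down (+ (suc n)) =
  P.subst P (P.cong +_ (ℕ.+-comm n 1))
    (up (+ n) (ℤ-bidirectional-induction P base up down (+ n)))
ℤ-bidirectional-induction P base up down -[1+ 0 ] = down -[1+ 0 ] base
ℤ-bidirectional-induction P base up down -[1+ suc n ] =
  down -[1+ suc n ] (ℤ-bidirectional-induction P base up down -[1+ n ])

module _ {c ℓ} (R : CommutativeRing c ℓ) where
  open CommutativeRing R
  open import Algebra.Properties.CommutativeSemigroup +-commutativeSemigroup using (interchange)
  open import Algebra.Properties.Ring ring using (-‿involutive; -‿+-comm; -‿distribˡ-*; +-inverseˡ-unique)
  open import Algebra.Solver.Ring.NaturalCoefficients.Default commutativeSemiring using (solve; _:=_; _:+_; _:*_)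
  open import Relation.Binary.Reasoning.Setoid setoid

  reindex : (f : ℤ → Carrier) {i j : ℤ} → i ≡ j → f i ≈ f j
  reindex f = reflexive ∘ P.cong f

  x+z≈y+w⇒[x-y]+[z-w]≈0 : ∀ {x y z w} → x + z ≈ y + w → (x - y) + (z - w) ≈ 0#
  x+z≈y+w⇒[x-y]+[z-w]≈0 {x} {y} {z} {w} eq = begin
    (x - y) + (z - w)      ≈⟨ interchange x (- y) z (- w) ⟩
    (x + z) + (- y + - w)  ≈⟨ +-cong eq (-‿+-comm y w) ⟩
    (y + w) - (y + w)      ≈⟨ -‿inverseʳ (y + w) ⟩
    0#                     ∎

  shift-isGenFib : ∀ {f} → IsGenFib R f → ∀ k → IsGenFib R (λ t → f (k ℤ.+ t))
  shift-isGenFib {f} hf k t = begin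
    f (k ℤ.+ (t ℤ.+ + 2))                  ≈⟨ reindex f (P.sym (ℤP.+-assoc k t (+ 2))) ⟩
    f (k ℤ.+ t ℤ.+ + 2)                    ≈⟨ hf (k ℤ.+ t) ⟩
    f (k ℤ.+ t ℤ.+ + 1) + f (k ℤ.+ t)      ≈⟨ +-congʳ (reindex f (ℤP.+-assoc k t (+ 1))) ⟩
    f (k ℤ.+ (t ℤ.+ + 1)) + f (k ℤ.+ t)    ∎

  +-isGenFib : ∀ {f g} → IsGenFib R f → IsGenFib R g → IsGenFib R (λ t → f t + g t)
  +-isGenFib {f} {g} hf hg t = begin
    f (t ℤ.+ + 2) + g (t ℤ.+ + 2)                            ≈⟨ +-cong (hf t) (hg t) ⟩
    (f (t ℤ.+ + 1) + f t) + (g (t ℤ.+ + 1) + g t)            ≈⟨ interchange _ _ _ _ ⟩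
    (f (t ℤ.+ + 1) + g (t ℤ.+ + 1)) + (f t + g t)            ∎

  -‿isGenFib : ∀ {f} → IsGenFib R f → IsGenFib R (λ t → - f t)
  -‿isGenFib hf t = trans (-‿cong (hf t)) (sym (-‿+-comm _ _))

  *ˡ-isGenFib : ∀ {f} x → IsGenFib R f → IsGenFib R (λ t → x * f t)
  *ˡ-isGenFib x hf t = trans (*-congˡ (hf t)) (distribˡ x _ _)

  *ʳ-isGenFib : ∀ {f} x → IsGenFib R f → IsGenFib R (λ t → f t * x)
  *ʳ-isGenFib x hf t = trans (*-congʳ (hf t)) (distribʳ x _ _)

  isGenFib-+1+1 : ∀ {f} → IsGenFib R f → ∀ i → f (i ℤ.+ + 1 ℤ.+ + 1) ≈ f (i ℤ.+ + 1) + f i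
  isGenFib-+1+1 {f} hf i = trans (reindex f (ℤP.+-assoc i (+ 1) (+ 1))) (hf i)

  isGenFib-zero : ∀ {f} → IsGenFib R f → f (+ 0) ≈ 0# → f (+ 1) ≈ 0# → ∀ i → f i ≈ 0#
  isGenFib-zero {f} hf f0≈0 f1≈0 = proj₁ ∘ ℤ-bidirectional-induction VanishesFrom (f0≈0 , f1≈0) up down
    where
    VanishesFrom : ℤ → Set ℓ
    VanishesFrom i = f i ≈ 0# × f (i ℤ.+ + 1) ≈ 0#

    up : ∀ i → VanishesFrom i → VanishesFrom (i ℤ.+ + 1)
    up i (fi≈0 , fi+1≈0) = fi+1≈0 , (begin
      f (i ℤ.+ + 1 ℤ.+ + 1)  ≈⟨ isGenFib-+1+1 hf i ⟩
      f (i ℤ.+ + 1) + f i    ≈⟨ +-cong fi+1≈0 fi≈0 ⟩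
      0# + 0#                ≈⟨ +-identityˡ 0# ⟩
      0#                     ∎)

    down : ∀ i → VanishesFrom (i ℤ.+ + 1) → VanishesFrom i
    down i (fi+1≈0 , fi+2≈0) = (begin
      f i                    ≈⟨ sym (+-identityˡ (f i)) ⟩
      0# + f i               ≈⟨ +-congʳ (sym fi+1≈0) ⟩
      f (i ℤ.+ + 1) + f i    ≈⟨ sym (isGenFib-+1+1 hf i) ⟩
      f (i ℤ.+ + 1 ℤ.+ + 1)  ≈⟨ fi+2≈0 ⟩
      0#                     ∎) , fi+1≈0

  negOnePow-+1 : ∀ i → negOnePow R (i ℤ.+ + 1) ≈ - negOnePow R i
  negOnePow-+1 (+ n)        = reflexive (P.cong (negOnePowℕ R) (ℕ.+-comm n 1))
  negOnePow-+1 -[1+ 0 ]     = sym (-‿involutive 1#)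
  negOnePow-+1 -[1+ suc n ] = sym (-‿involutive _)

  alternating⇒negOnePow : ∀ {D : ℤ → Carrier} → (∀ i → D (i ℤ.+ + 1) ≈ - D i) →
    ∀ i → D i ≈ negOnePow R i * D (+ 0)
  alternating⇒negOnePow {D} alt = ℤ-bidirectional-induction Closed base up down
    where
    Closed : ℤ → Set ℓ
    Closed i = D i ≈ negOnePow R i * D (+ 0)

    base : Closed (+ 0)
    base = sym (*-identityˡ (D (+ 0)))

    up : ∀ i → Closed i → Closed (i ℤ.+ + 1)
    up i eq = begin
      D (i ℤ.+ + 1)                      ≈⟨ alt i ⟩
      - D i                              ≈⟨ -‿cong eq ⟩
      - (negOnePow R i * D (+ 0))        ≈⟨ -‿distribˡ-* _ _ ⟩
      - negOnePow R i * D (+ 0)          ≈⟨ *-congʳ (sym (negOnePow-+1 i)) ⟩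
      negOnePow R (i ℤ.+ + 1) * D (+ 0)  ∎

    down : ∀ i → Closed (i ℤ.+ + 1) → Closed i
    down i eq = begin
      D i                                    ≈⟨ sym (-‿involutive (D i)) ⟩
      - - D i                                ≈⟨ -‿cong (sym (alt i)) ⟩
      - D (i ℤ.+ + 1)                        ≈⟨ -‿cong eq ⟩
      - (negOnePow R (i ℤ.+ + 1) * D (+ 0))  ≈⟨ -‿distribˡ-* _ _ ⟩
      - negOnePow R (i ℤ.+ + 1) * D (+ 0)    ≈⟨ *-congʳ (-‿cong (negOnePow-+1 i)) ⟩
      - - negOnePow R i * D (+ 0)            ≈⟨ *-congʳ (-‿involutive _) ⟩
      negOnePow R i * D (+ 0)                ∎

  cross : (G H : ℤ → Carrier) (s p a : ℤ) → Carrier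
  cross G H s p a = G (a ℤ.+ p) * H (a ℤ.+ s) - G a * H (a ℤ.+ s ℤ.+ p)

  module _ {G H : ℤ → Carrier} (hG : IsGenFib R G) (hH : IsGenFib R H) (s : ℤ) where

    cross-isGenFib : ∀ a → IsGenFib R (λ p → cross G H s p a)
    cross-isGenFib a = +-isGenFib (*ʳ-isGenFib _ (shift-isGenFib hG a))
                                  (-‿isGenFib (*ˡ-isGenFib _ (shift-isGenFib hH (a ℤ.+ s))))

    cross-at-0 : ∀ a → cross G H s (+ 0) a ≈ 0#
    cross-at-0 a = begin
      G (a ℤ.+ + 0) * H (a ℤ.+ s) - G a * H (a ℤ.+ s ℤ.+ + 0)
        ≈⟨ +-congʳ (*-congʳ (reindex G (ℤP.+-identityʳ a))) ⟩
      G a * H (a ℤ.+ s) - G a * H (a ℤ.+ s ℤ.+ + 0)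
        ≈⟨ +-congˡ (-‿cong (*-congˡ (reindex H (ℤP.+-identityʳ (a ℤ.+ s))))) ⟩
      G a * H (a ℤ.+ s) - G a * H (a ℤ.+ s)
        ≈⟨ -‿inverseʳ _ ⟩
      0# ∎

    cross-sum-vanishes-at-1 : ∀ a → cross G H s (+ 1) (a ℤ.+ + 1) + cross G H s (+ 1) a ≈ 0#
    cross-sum-vanishes-at-1 a = begin
      (G (a ℤ.+ + 1 ℤ.+ + 1) * H (a ℤ.+ + 1 ℤ.+ s) - G (a ℤ.+ + 1) * H (a ℤ.+ + 1 ℤ.+ s ℤ.+ + 1))
        + (g₁ * h₀ - g₀ * h₁)
        ≈⟨ +-congʳ (+-cong (*-cong (isGenFib-+1+1 hG a) (reindex H a+1+s≡a+s+1))
                           (-‿cong (*-congˡ (trans (reindex H (P.cong (ℤ._+ + 1) a+1+s≡a+s+1))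
                                                   (isGenFib-+1+1 hH (a ℤ.+ s)))))) ⟩
      ((g₁ + g₀) * h₁ - g₁ * (h₁ + h₀)) + (g₁ * h₀ - g₀ * h₁)
        ≈⟨ x+z≈y+w⇒[x-y]+[z-w]≈0 (solve 4 (λ g₀ g₁ h₀ h₁ →
              ((g₁ :+ g₀) :* h₁) :+ (g₁ :* h₀) := (g₁ :* (h₁ :+ h₀)) :+ (g₀ :* h₁)) refl g₀ g₁ h₀ h₁) ⟩
      0# ∎
      where
      g₀ = G a
      g₁ = G (a ℤ.+ + 1)
      h₀ = H (a ℤ.+ s)
      h₁ = H (a ℤ.+ s ℤ.+ + 1)
      a+1+s≡a+s+1 : a ℤ.+ + 1 ℤ.+ s ≡ a ℤ.+ s ℤ.+ + 1
      a+1+s≡a+s+1 = xy∙z≈xz∙y a (+ 1) s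

    cross-+1 : ∀ p a → cross G H s p (a ℤ.+ + 1) ≈ - cross G H s p a
    cross-+1 p a = +-inverseˡ-unique _ _
      (isGenFib-zero (+-isGenFib (cross-isGenFib (a ℤ.+ + 1)) (cross-isGenFib a))
                     (trans (+-cong (cross-at-0 (a ℤ.+ + 1)) (cross-at-0 a)) (+-identityˡ 0#))
                     (cross-sum-vanishes-at-1 a) p)

    cross≈negOnePow* : ∀ p a → cross G H s p a ≈ negOnePow R a * (G p * H s - G (+ 0) * H (s ℤ.+ p))
    cross≈negOnePow* p a = trans (alternating⇒negOnePow (cross-+1 p) a)
      (*-congˡ (reflexive (P.cong₂ (λ i j → G i * H j - G (+ 0) * H (j ℤ.+ p))
                                   (ℤP.+-identityˡ p) (ℤP.+-identityˡ s))))

open import Data.Integer using (_+_; _-_)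

mainTheorem13 : ∀ {c ℓ} (R : CommutativeRing c ℓ) (G H : ℤ → CommutativeRing.Carrier R) →
    IsGenFib R G → IsGenFib R H →
    ∀ (n m r p q : ℤ) →
    CommutativeRing._≈_ R
      (CommutativeRing._-_ R
        (CommutativeRing._*_ R (G (n + r + p)) (H (m + r + q)))
        (CommutativeRing._*_ R (G (n + r)) (H (m + r + p + q))))
      (CommutativeRing._*_ R (negOnePow R (n + r))
        (CommutativeRing._-_ R
          (CommutativeRing._*_ R (G p) (H (m - n + q)))
          (CommutativeRing._*_ R (G (+ 0)) (H (m - n + p + q)))))
mainTheorem13 R G H hG hH n m r p q =
  R.trans (R.reflexive (P.cong₂ (λ i j → G (n + r + p) R.* H i R.- G (n + r) R.* H j)
                                (lhs-index₁ n m r q) (lhs-index₂ n m r p q)))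
  (R.trans (cross≈negOnePow* R hG hH (m - n + q) p (n + r))
           (R.*-congˡ (R.reflexive (P.cong (λ j → G p R.* H (m - n + q) R.- G (+ 0) R.* H j)
                                           (rhs-index m n p q)))))
  where
  module R = CommutativeRing R
  lhs-index₁ : ∀ n m r q → m + r + q ≡ n + r + (m - n + q)
  lhs-index₁ = ℤ-Solver.solve-∀
  lhs-index₂ : ∀ n m r p q → m + r + p + q ≡ n + r + (m - n + q) + p
  lhs-index₂ = ℤ-Solver.solve-∀
  rhs-index : ∀ m n p q → m - n + q + p ≡ m - n + p + q
  rhs-index = ℤ-Solver.solve-∀
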